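{- Let $p\ge 2$ be an integer and let $G=(V,E)$ be a connected finite undirected graph that has no 2-connected component which has at least $p$ vertices and is not a cycle. Then $|E|<p\cdot|V|$.
   Context: A 2-connected component (biconnected component, block) of $G$ is a maximal 2-connected subgraph; its size is its number of vertices. -}

module Defs where

open import Data.Nat using (ℕ; zero; suc; _+_; _≤_; NonZero)
open import Data.Nat.DivMod using (_mod_)
open import Data.Bool using (Bool; true; false; _∧_; not; if_then_else_)
open import Data.Fin using (Fin; toℕ; _≟_; _<?_)
open import Data.List using (List; map; allFin)
open import Data.Nat.ListAction using (sum)
open import Data.Product using (Σ; ∃; _×_; _,_)
open import Data.Sum using (_⊎_)
open import Function.Definitions using (Injective)
open import Relation.Binary.PropositionalEquality using (_≡_)
open import Relation.Nullary.Decidable using (⌊_⌋)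

record Graph (n : ℕ) : Set where
  field
    adj    : Fin n → Fin n → Bool
    sym    : ∀ i j → adj i j ≡ adj j i
    irrefl : ∀ i → adj i i ≡ false
open Graph public

edgeCount : ∀ {n} → Graph n → ℕ
edgeCount {n} G =
  sum (map (λ i → sum (map (λ j → if ⌊ i <? j ⌋ ∧ adj G i j then 1 else 0)
                           (allFin n)))
           (allFin n))

record Subgraph {n : ℕ} (G : Graph n) : Set where
  field
    V      : Fin n → Bool
    E      : Fin n → Fin n → Bool
    E-sym  : ∀ i j → E i j ≡ E j i
    E⊆adj  : ∀ i j → E i j ≡ true → adj G i j ≡ true
    E⊆V    : ∀ i j → E i j ≡ true → V i ≡ true
open Subgraph public

whole : ∀ {n} (G : Graph n) → Subgraph G
whole G = record
  { V = λ _ → true ; E = adj G ; E-sym = sym G ; E⊆adj = λ _ _ e → e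
  ; E⊆V = λ _ _ _ → Relation.Binary.PropositionalEquality.refl }

size : ∀ {n} {G : Graph n} → Subgraph G → ℕ
size {n} H = sum (map (λ i → if V H i then 1 else 0) (allFin n))

_⊑_ : ∀ {n} {G : Graph n} → Subgraph G → Subgraph G → Set
H ⊑ H' = (∀ i → V H i ≡ true → V H' i ≡ true)
       × (∀ i j → E H i j ≡ true → E H' i j ≡ true)

_─_ : ∀ {n} {G : Graph n} → Subgraph G → Fin n → Subgraph G
_─_ {n} {G} H x = record
  { V = λ i → V H i ∧ not ⌊ i ≟ x ⌋
  ; E = λ i j → E H i j ∧ (not ⌊ i ≟ x ⌋ ∧ not ⌊ j ≟ x ⌋)
  ; E-sym = pf-sym
  ; E⊆adj = λ i j e → E⊆adj H i j (∧-l e)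
  ; E⊆V = pf-V }
  where
  open import Data.Bool.Properties using (∧-comm; ∧-assoc)
  open import Relation.Binary.PropositionalEquality using (refl; cong₂; trans)
  ∧-l : ∀ {a b} → a ∧ b ≡ true → a ≡ true
  ∧-l {true} _ = refl
  ∧-r : ∀ {a b} → a ∧ b ≡ true → b ≡ true
  ∧-r {true} e = e
  pf-sym : ∀ i j → (E H i j ∧ (not ⌊ i ≟ x ⌋ ∧ not ⌊ j ≟ x ⌋))
                 ≡ (E H j i ∧ (not ⌊ j ≟ x ⌋ ∧ not ⌊ i ≟ x ⌋))
  pf-sym i j = cong₂ _∧_ (E-sym H i j) (∧-comm (not ⌊ i ≟ x ⌋) _)
  pf-V : ∀ i j → (E H i j ∧ (not ⌊ i ≟ x ⌋ ∧ not ⌊ j ≟ x ⌋)) ≡ true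
       → (V H i ∧ not ⌊ i ≟ x ⌋) ≡ true
  pf-V i j e with E H i j in eq | not ⌊ i ≟ x ⌋
  pf-V i j e  | true | true = trans (cong₂ _∧_ (E⊆V H i j eq) refl) refl
  pf-V i j () | true | false
  pf-V i j () | false | _

data Reach {n} {G : Graph n} (H : Subgraph G) : Fin n → Fin n → Set where
  here : ∀ {u} → V H u ≡ true → Reach H u u
  step : ∀ {u w v} → E H u w ≡ true → Reach H w v → Reach H u v

Connected : ∀ {n} {G : Graph n} → Subgraph G → Set
Connected {n} H = (∃ λ (u : Fin n) → V H u ≡ true)
                × (∀ u v → V H u ≡ true → V H v ≡ true → Reach H u v)

-- 2-connected (Diestel): more than 2 vertices, and H - X connected for |X| < 2
TwoConnected : ∀ {n} {G : Graph n} → Subgraph G → Set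
TwoConnected H = (3 ≤ size H) × Connected H
               × (∀ x → V H x ≡ true → Connected (H ─ x))

IsTwoConnectedComponent : ∀ {n} {G : Graph n} → Subgraph G → Set
IsTwoConnectedComponent {G = G} H =
  TwoConnected H × (∀ (H' : Subgraph G) → TwoConnected H' → H ⊑ H' → H' ⊑ H)

next : ∀ {m} → Fin (suc m) → Fin (suc m)
next {m} j = (suc (toℕ j)) mod (suc m)

IsCycle : ∀ {n} {G : Graph n} → Subgraph G → Set
IsCycle {n} H =
  Σ ℕ λ m → (2 ≤ m) × Σ (Fin (suc m) → Fin n) λ f →
    Injective _≡_ _≡_ f
    × (∀ i → V H i ≡ true → ∃ λ j → f j ≡ i)
    × (∀ j → V H (f j) ≡ true)
    × (∀ a b → E H a b ≡ true →
         ∃ λ j → (f j ≡ a × f (next j) ≡ b) ⊎ (f j ≡ b × f (next j) ≡ a))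
    × (∀ j → E H (f j) (f (next j)) ≡ true)

-- Call a vertex set S sparse if e(G[S]) ≤ p (|S| − 1); every nonempty S is sparse, by induction
-- on |S|. If G[S] has a vertex of degree at most p, delete it. If G[S] has a separation by at most
-- one vertex, its two sides are smaller, hence sparse, and their bounds add up to the bound for S.
-- Otherwise G[S] is 2-connected with minimum degree greater than p ≥ 2, so it lies in a block with
-- more than p vertices that contains a vertex of degree at least 3; that block is not a cycle,
-- contrary to the hypothesis. For S = V this gives |E| ≤ p (|V| − 1) < p |V|.
-- The 2-connectivity of G[S] and the block containing it are only obtained under double negation,
-- which suffices because they are used to derive a contradiction.

module Submission where

open import Defs hiding (sym)

open import Algebra.Bundles using (CommutativeMonoid)
open import Data.Bool using (Bool; true; false; _∧_; _∨_; not; if_then_else_)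
open import Data.Bool.Properties
  using (∧-conicalˡ; ∧-conicalʳ; ∧-identityʳ; ∧-zeroʳ; ∧-commutativeMonoid;
         ∨-conicalˡ; ∨-conicalʳ; ∨-zeroʳ; ∨-identityʳ; ∨-idem; ¬-not)
  renaming (_≟_ to _≟ᵇ_)
open import Data.Empty using (⊥; ⊥-elim)
open import Data.Fin using (Fin; zero; suc; toℕ; punchIn; _≟_; _<?_)
import Data.Fin.Properties as Fin
open import Data.List using (map; tabulate; allFin)
open import Data.Nat using (ℕ; zero; suc; _+_; _*_; _∸_; _≤_; _<_; _≤?_; z≤n; s≤s)
open import Data.Nat.DivMod using (_%_; m<n⇒m%n≡m; n%n≡0)
open import Data.Nat.Induction using (<-wellFounded)
import Data.Nat.ListAction as List
open import Data.Nat.Properties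
  using (≤-refl; ≤-reflexive; ≤-trans; ≤-pred; ≤⇒≯; <⇒≱; ≮⇒≥; ≰⇒>; m≤n⇒m<n∨m≡n; n≤0⇒n≡0; n<1⇒n≡0;
         m≤m+n; m≤n+m; m<m+n; suc-injective; +-assoc; +-comm; +-identityʳ; +-mono-≤; +-monoˡ-≤;
         +-monoʳ-≤; +-mono-<; +-cancelˡ-≤; +-cancelʳ-≤; *-identityʳ; *-suc; *-distribˡ-+;
         *-distribʳ-+; *-monoʳ-≤; ∸-monoʳ-<; +-0-commutativeMonoid; +-commutativeSemigroup;
         module ≤-Reasoning)
open import Data.Product using (∃; _×_; _,_; proj₁; proj₂)
open import Data.Sum using (_⊎_; inj₁; inj₂)
open import Function using (_∘_; case_of_)
open import Induction.WellFounded using (Acc; acc)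
open import Relation.Binary using (tri<; tri≈; tri>)
open import Relation.Binary.PropositionalEquality
  using (_≡_; _≢_; refl; sym; trans; cong; cong₂; subst; module ≡-Reasoning)
open import Relation.Nullary using (¬_; Dec; yes; no)
open import Relation.Nullary.Decidable
  using (⌊_⌋; _×-dec_; isYes≗does; dec-true; dec-false; decidable-stable; ¬¬-excluded-middle)
open import Relation.Nullary.Negation using (¬¬-map)

open import Algebra.Properties.CommutativeMonoid.Sum +-0-commutativeMonoid
  using (sum; sum-syntax; sum-cong-≗; ∑-distrib-+; ∑-comm; sum-remove)
open import Algebra.Properties.CommutativeSemigroup +-commutativeSemigroup
  using (interchange)
open import Algebra.Properties.CommutativeSemigroup (CommutativeMonoid.commutativeSemigroup ∧-commutativeMonoid)
  using () renaming (x∙yz≈y∙xz to ∧-left-swap)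

private variable
  n : ℕ

m+m≤n+n⇒m≤n : ∀ {m n} → m + m ≤ n + n → m ≤ n
m+m≤n+n⇒m≤n m+m≤n+n = ≮⇒≥ λ n<m → <⇒≱ (+-mono-< n<m n<m) m+m≤n+n

+-mono-≤-reflect : ∀ {a b c d} → a ≤ c → b ≤ d → c + d ≤ a + b → c ≤ a × d ≤ b
+-mono-≤-reflect {a} {b} {c} {d} a≤c b≤d cd≤ab =
  +-cancelʳ-≤ d c a (≤-trans cd≤ab (+-monoʳ-≤ a b≤d)) ,
  +-cancelˡ-≤ c d b (≤-trans cd≤ab (+-monoˡ-≤ b a≤c))

⌊⌋-true : ∀ {A : Set} (a? : Dec A) → A → ⌊ a? ⌋ ≡ true
⌊⌋-true a? a = trans (isYes≗does a?) (dec-true a? a)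

⌊⌋-false : ∀ {A : Set} (a? : Dec A) → ¬ A → ⌊ a? ⌋ ≡ false
⌊⌋-false a? ¬a = trans (isYes≗does a?) (dec-false a? ¬a)

∧-true : ∀ {x y} → x ≡ true → y ≡ true → x ∧ y ≡ true
∧-true = cong₂ _∧_

∨-resolveʳ : ∀ {x y} → x ∨ y ≡ true → y ≡ false → x ≡ true
∨-resolveʳ {true}  _      _       = refl
∨-resolveʳ {false} y≡true y≡false = trans (sym y≡false) y≡true

⟦_⟧ : Bool → ℕ
⟦ b ⟧ = if b then 1 else 0

⟦⟧-mono : ∀ {x y} → (x ≡ true → y ≡ true) → ⟦ x ⟧ ≤ ⟦ y ⟧
⟦⟧-mono {false} _   = z≤n
⟦⟧-mono {true}  x⇒y rewrite x⇒y refl = ≤-refl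

⟦⟧-reflect : ∀ {x y} → ⟦ x ⟧ ≤ ⟦ y ⟧ → x ≡ true → y ≡ true
⟦⟧-reflect {y = true}  _   _    = refl
⟦⟧-reflect {y = false} 1≤0 refl = case 1≤0 of λ ()

⟦∨⟧+⟦∧⟧ : ∀ x y → ⟦ x ∨ y ⟧ + ⟦ x ∧ y ⟧ ≡ ⟦ x ⟧ + ⟦ y ⟧
⟦∨⟧+⟦∧⟧ true  true  = refl
⟦∨⟧+⟦∧⟧ true  false = refl
⟦∨⟧+⟦∧⟧ false true  = refl
⟦∨⟧+⟦∧⟧ false false = refl

¬¬-Π : ∀ {P : Fin n → Set} → (∀ i → ¬ ¬ P i) → ¬ ¬ (∀ i → P i)
¬¬-Π {zero}  _   k = k (λ ())
¬¬-Π {suc n} ¬¬P k = ¬¬P zero (λ P₀ → ¬¬-Π (¬¬P ∘ suc) (λ P₊ → k (Fin.∀-cons P₀ P₊)))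

¬¬-→ : ∀ {A B : Set} → (A → ¬ ¬ B) → ¬ ¬ (A → B)
¬¬-→ a⇒¬¬b k = k (λ a → ⊥-elim (a⇒¬¬b a (λ b → k (λ _ → b))))

-- Finite sums

sum-map-tabulate : ∀ {A : Set} {n} (f : A → ℕ) (g : Fin n → A) →
                   List.sum (map f (tabulate g)) ≡ sum (f ∘ g)
sum-map-tabulate {n = zero}  f g = refl
sum-map-tabulate {n = suc n} f g = cong (f (g zero) +_) (sum-map-tabulate f (g ∘ suc))

∑-zero : {f : Fin n → ℕ} → (∀ i → f i ≡ 0) → sum f ≡ 0
∑-zero {zero}  f≡0 = refl
∑-zero {suc n} f≡0 = cong₂ _+_ (f≡0 zero) (∑-zero (f≡0 ∘ suc))

∑-const : ∀ c → sum {n} (λ _ → c) ≡ n * c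
∑-const {zero}  c = refl
∑-const {suc n} c = cong (c +_) (∑-const {n} c)

∑-mono-≤ : {f g : Fin n → ℕ} → (∀ i → f i ≤ g i) → sum f ≤ sum g
∑-mono-≤ {zero}  f≤g = z≤n
∑-mono-≤ {suc n} f≤g = +-mono-≤ (f≤g zero) (∑-mono-≤ (f≤g ∘ suc))

∑-mono-≤-reflect : {f g : Fin n → ℕ} → (∀ i → f i ≤ g i) → sum g ≤ sum f → ∀ i → g i ≤ f i
∑-mono-≤-reflect {suc n} f≤g ∑g≤∑f i
  with +-mono-≤-reflect (f≤g zero) (∑-mono-≤ (f≤g ∘ suc)) ∑g≤∑f
∑-mono-≤-reflect {suc n} f≤g ∑g≤∑f zero    | g₀≤f₀ , _ = g₀≤f₀
∑-mono-≤-reflect {suc n} f≤g ∑g≤∑f (suc i) | _ , rest = ∑-mono-≤-reflect (f≤g ∘ suc) rest i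

∑-term-≤ : ∀ (f : Fin n → ℕ) i → f i ≤ sum f
∑-term-≤ f zero    = m≤m+n _ _
∑-term-≤ f (suc i) = ≤-trans (∑-term-≤ (f ∘ suc) i) (m≤n+m _ _)

∑-positive : (f : Fin n → ℕ) → 1 ≤ sum f → ∃ λ i → 1 ≤ f i
∑-positive {suc n} f 1≤∑ with f zero in f₀≡
... | suc _ = zero , subst (1 ≤_) (sym f₀≡) (s≤s z≤n)
... | zero with ∑-positive (f ∘ suc) 1≤∑
...   | i , 1≤fi = suc i , 1≤fi

∑-if-≟ : ∀ (g : Fin n → ℕ) v → sum (λ i → if ⌊ i ≟ v ⌋ then g i else 0) ≡ g v
∑-if-≟ {suc n} g v = begin
  sum δg                          ≡⟨ sum-remove {i = v} δg ⟩
  δg v + sum (δg ∘ punchIn v)     ≡⟨ cong₂ _+_ (cong (if_then g v else 0) (⌊⌋-true (v ≟ v) refl))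
                                               (∑-zero δg-off-v) ⟩
  g v + 0                         ≡⟨ +-identityʳ (g v) ⟩
  g v                             ∎
  where
  open ≡-Reasoning
  δg : Fin (suc n) → ℕ
  δg i = if ⌊ i ≟ v ⌋ then g i else 0
  δg-off-v : ∀ j → δg (punchIn v j) ≡ 0
  δg-off-v j = cong (if_then g (punchIn v j) else 0) (⌊⌋-false (punchIn v j ≟ v) (Fin.punchInᵢ≢i v j))

-- Vertex sets

VertexSet : ℕ → Set
VertexSet n = Fin n → Bool

∅ full : VertexSet n
∅    _ = false
full _ = true

⁅_⁆ : Fin n → VertexSet n
⁅ v ⁆ j = ⌊ j ≟ v ⌋

_∪_ _∩_ : VertexSet n → VertexSet n → VertexSet n
(S ∪ T) j = S j ∨ T j
(S ∩ T) j = S j ∧ T j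

_∖_ : VertexSet n → Fin n → VertexSet n
(S ∖ v) j = S j ∧ not ⌊ j ≟ v ⌋

_⊆_ : VertexSet n → VertexSet n → Set
S ⊆ T = ∀ i → S i ≡ true → T i ≡ true

∖-⊆ : ∀ (S : VertexSet n) v → (S ∖ v) ⊆ S
∖-⊆ S v j = ∧-conicalˡ (S j) _

∖-≢ : ∀ (S : VertexSet n) v {j} → (S ∖ v) j ≡ true → j ≢ v
∖-≢ S v {j} j∈S∖v refl =
  case trans (sym (cong not (⌊⌋-true (j ≟ j) refl))) (∧-conicalʳ (S j) _ j∈S∖v) of λ ()

∖-∪-⁅⁆ : ∀ {S : VertexSet n} {x} → S x ≡ true → ∀ j → S j ≡ ((S ∖ x) ∪ ⁅ x ⁆) j
∖-∪-⁅⁆ {S = S} {x} x∈S j with j ≟ x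
... | yes refl = trans x∈S (sym (∨-zeroʳ _))
... | no  _    = sym (trans (∨-identityʳ _) (∧-identityʳ (S j)))

card : VertexSet n → ℕ
card {n} S = ∑[ i < n ] ⟦ S i ⟧

card-cong : ∀ {S T : VertexSet n} → (∀ j → S j ≡ T j) → card S ≡ card T
card-cong S≗T = sum-cong-≗ (λ j → cong ⟦_⟧ (S≗T j))

card-mono : ∀ {S T : VertexSet n} → S ⊆ T → card S ≤ card T
card-mono S⊆T = ∑-mono-≤ (λ i → ⟦⟧-mono (S⊆T i))

card-reflect : ∀ {S T : VertexSet n} → S ⊆ T → card T ≤ card S → T ⊆ S
card-reflect S⊆T |T|≤|S| i = ⟦⟧-reflect (∑-mono-≤-reflect (λ i → ⟦⟧-mono (S⊆T i)) |T|≤|S| i)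

card-⊂ : ∀ {S T : VertexSet n} {v} → S ⊆ T → T v ≡ true → S v ≡ false → card S < card T
card-⊂ {v = v} S⊆T v∈T v∉S =
  ≰⇒> (λ |T|≤|S| → case trans (sym v∉S) (card-reflect S⊆T |T|≤|S| v v∈T) of λ ())

card-full : card {n} full ≡ n
card-full {n} = trans (∑-const {n} 1) (*-identityʳ n)

card-≤ : ∀ (S : VertexSet n) → card S ≤ n
card-≤ S = ≤-trans (card-mono {S = S} {T = full} (λ _ _ → refl)) (≤-reflexive card-full)

card-∅ : card {n} ∅ ≡ 0
card-∅ {n} = ∑-zero {n} (λ _ → refl)

card-⁅⁆ : ∀ (v : Fin n) → card ⁅ v ⁆ ≡ 1
card-⁅⁆ v = ∑-if-≟ (λ _ → 1) v

card-∖ : ∀ {S : VertexSet n} {v} → S v ≡ true → card S ≡ suc (card (S ∖ v))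
card-∖ {n} {S} {v} v∈S = begin
  card S                                    ≡⟨ sum-cong-≗ split ⟩
  ∑[ j < n ] (⟦ (S ∖ v) j ⟧ + ⟦ ⁅ v ⁆ j ⟧)  ≡⟨ ∑-distrib-+ (λ j → ⟦ (S ∖ v) j ⟧) (λ j → ⟦ ⁅ v ⁆ j ⟧) ⟩
  card (S ∖ v) + card ⁅ v ⁆                 ≡⟨ cong (card (S ∖ v) +_) (card-⁅⁆ v) ⟩
  card (S ∖ v) + 1                          ≡⟨ +-comm _ 1 ⟩
  suc (card (S ∖ v))                        ∎
  where
  open ≡-Reasoning
  split : ∀ j → ⟦ S j ⟧ ≡ ⟦ (S ∖ v) j ⟧ + ⟦ ⁅ v ⁆ j ⟧
  split j with j ≟ v
  ... | yes refl rewrite v∈S = refl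
  ... | no  _    rewrite ∧-identityʳ (S j) = sym (+-identityʳ _)

card-∪-∩ : ∀ (S T : VertexSet n) → card (S ∪ T) + card (S ∩ T) ≡ card S + card T
card-∪-∩ {n} S T = begin
  card (S ∪ T) + card (S ∩ T)
    ≡⟨ ∑-distrib-+ (λ j → ⟦ S j ∨ T j ⟧) (λ j → ⟦ S j ∧ T j ⟧) ⟨
  ∑[ j < n ] (⟦ S j ∨ T j ⟧ + ⟦ S j ∧ T j ⟧)
    ≡⟨ sum-cong-≗ (λ j → ⟦∨⟧+⟦∧⟧ (S j) (T j)) ⟩
  ∑[ j < n ] (⟦ S j ⟧ + ⟦ T j ⟧)
    ≡⟨ ∑-distrib-+ (λ j → ⟦ S j ⟧) (λ j → ⟦ T j ⟧) ⟩
  card S + card T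
    ∎
  where open ≡-Reasoning

member⇒card-positive : ∀ {S : VertexSet n} {v} → S v ≡ true → 1 ≤ card S
member⇒card-positive {S = S} {v} v∈S =
  ≤-trans (⟦⟧-mono {true} (λ _ → v∈S)) (∑-term-≤ (λ j → ⟦ S j ⟧) v)

card-positive⇒member : ∀ (S : VertexSet n) → 1 ≤ card S → ∃ λ v → S v ≡ true
card-positive⇒member S 1≤|S| with ∑-positive (λ j → ⟦ S j ⟧) 1≤|S|
... | v , 1≤⟦Sv⟧ = v , ⟦⟧-reflect {true} 1≤⟦Sv⟧ refl

pick-member : ∀ (S : VertexSet n) {k} → suc k ≤ card S → ∃ λ v → S v ≡ true × k ≤ card (S ∖ v)
pick-member S k<|S| with card-positive⇒member S (≤-trans (s≤s z≤n) k<|S|)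
... | v , v∈S = v , v∈S , ≤-pred (≤-trans k<|S| (≤-reflexive (card-∖ {S = S} v∈S)))

ThreeDistinctMembers : VertexSet n → Set
ThreeDistinctMembers S =
  ∃ λ x → ∃ λ y → ∃ λ z → S x ≡ true × S y ≡ true × S z ≡ true × x ≢ y × x ≢ z × y ≢ z

three-members : ∀ (S : VertexSet n) → 3 ≤ card S → ThreeDistinctMembers S
three-members S 3≤|S| with pick-member S 3≤|S|
... | x , x∈S , 2≤ with pick-member (S ∖ x) 2≤
... | y , y∈S∖x , 1≤ with pick-member ((S ∖ x) ∖ y) 1≤
... | z , z∈S∖x∖y , _ =
  x , y , z , x∈S , ∖-⊆ S x y y∈S∖x , ∖-⊆ S x z (∖-⊆ (S ∖ x) y z z∈S∖x∖y) ,
  (λ x≡y → ∖-≢ S x y∈S∖x (sym x≡y)) ,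
  (λ x≡z → ∖-≢ S x (∖-⊆ (S ∖ x) y z z∈S∖x∖y) (sym x≡z)) ,
  (λ y≡z → ∖-≢ (S ∖ x) y z∈S∖x∖y (sym y≡z))

-- Arc counts and sparsity

module _ {n : ℕ} (G : Graph n) where

  arcs : VertexSet n → ℕ
  arcs S = ∑[ i < n ] ∑[ j < n ] ⟦ S i ∧ S j ∧ adj G i j ⟧

  neighbours : VertexSet n → Fin n → VertexSet n
  neighbours S v j = S j ∧ adj G v j

  degree : VertexSet n → Fin n → ℕ
  degree S v = card (neighbours S v)

  degree-≤ : ∀ S v → degree S v ≤ card (S ∖ v)
  degree-≤ S v = card-mono {S = neighbours S v} {T = S ∖ v} neighbour∈S∖v
    where
    neighbour∈S∖v : neighbours S v ⊆ (S ∖ v)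
    neighbour∈S∖v j j∼v with j ≟ v
    ... | yes refl = case trans (sym (irrefl G v)) (∧-conicalʳ (S v) _ j∼v) of λ ()
    ... | no  _    = trans (∧-identityʳ (S j)) (∧-conicalˡ (S j) _ j∼v)

  arcs-cong : ∀ {S T} → (∀ j → S j ≡ T j) → arcs S ≡ arcs T
  arcs-cong S≗T = sum-cong-≗ (λ i → sum-cong-≗ (λ j →
    cong₂ (λ a b → ⟦ a ∧ b ∧ adj G i j ⟧) (S≗T i) (S≗T j)))

  arcs-∖ : ∀ {S} {v} → S v ≡ true → arcs S ≡ arcs (S ∖ v) + (degree S v + degree S v)
  arcs-∖ {S} {v} v∈S = begin
    arcs S
      ≡⟨ sum-cong-≗ (λ i → sum-cong-≗ (split i)) ⟩
    ∑[ i < n ] ∑[ j < n ] (inner i j + (out i j + into i j))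
      ≡⟨ sum-cong-≗ (λ i → trans (∑-distrib-+ (inner i) _)
                                 (cong (sum (inner i) +_) (∑-distrib-+ (out i) (into i)))) ⟩
    ∑[ i < n ] (sum (inner i) + (sum (out i) + sum (into i)))
      ≡⟨ trans (∑-distrib-+ (λ i → sum (inner i)) _)
               (cong (arcs (S ∖ v) +_) (∑-distrib-+ (λ i → sum (out i)) _)) ⟩
    arcs (S ∖ v) + (∑[ i < n ] sum (out i) + ∑[ i < n ] sum (into i))
      ≡⟨ cong (arcs (S ∖ v) +_) (cong₂ _+_ out-degree into-degree) ⟩
    arcs (S ∖ v) + (degree S v + degree S v)
      ∎
    where
    open ≡-Reasoning
    inner out into : Fin n → Fin n → ℕ
    inner i j = ⟦ (S ∖ v) i ∧ (S ∖ v) j ∧ adj G i j ⟧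
    out   i j = if ⌊ i ≟ v ⌋ then ⟦ S j ∧ adj G i j ⟧ else 0
    into   i j = if ⌊ j ≟ v ⌋ then ⟦ S i ∧ adj G i j ⟧ else 0
    split : ∀ i j → ⟦ S i ∧ S j ∧ adj G i j ⟧ ≡ inner i j + (out i j + into i j)
    split i j with i ≟ v | j ≟ v
    ... | yes refl | yes refl rewrite v∈S | irrefl G v = refl
    ... | yes refl | no _     rewrite v∈S = sym (+-identityʳ _)
    ... | no _     | yes refl rewrite v∈S | ∧-identityʳ (S i) | ∧-zeroʳ (S i) = refl
    ... | no _     | no _     rewrite ∧-identityʳ (S i) | ∧-identityʳ (S j) = sym (+-identityʳ _)
    out-degree : ∑[ i < n ] sum (out i) ≡ degree S v
    out-degree = trans (∑-comm out) (sum-cong-≗ (λ j → ∑-if-≟ (λ i → ⟦ S j ∧ adj G i j ⟧) v))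
    into-degree : ∑[ i < n ] sum (into i) ≡ degree S v
    into-degree = sum-cong-≗ (λ i → trans (∑-if-≟ (λ j → ⟦ S i ∧ adj G i j ⟧) v)
                                        (cong (λ b → ⟦ S i ∧ b ⟧) (Graph.sym G i v)))

  arcs-card≤1 : ∀ {S} → card S ≤ 1 → arcs S ≡ 0
  arcs-card≤1 {S} |S|≤1 = ∑-zero row-zero
    where
    row-zero : ∀ i → ∑[ j < n ] ⟦ S i ∧ S j ∧ adj G i j ⟧ ≡ 0
    row-zero i with S i in i∈S
    ... | false = ∑-zero {n} (λ _ → refl)
    ... | true  = n≤0⇒n≡0 (≤-trans (degree-≤ S i)
                     (≤-pred (≤-trans (≤-reflexive (sym (card-∖ {S = S} i∈S))) |S|≤1)))

  arcs-∪-∩ : ∀ S T →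
    (∀ i j → S i ≡ true → T i ≡ false → T j ≡ true → S j ≡ false → adj G i j ≡ false) →
    arcs (S ∪ T) + arcs (S ∩ T) ≡ arcs S + arcs T
  arcs-∪-∩ S T no-cross = begin
    arcs (S ∪ T) + arcs (S ∩ T)
      ≡⟨ ∑-distrib-+ (λ i → sum (term (S ∪ T) i)) _ ⟨
    ∑[ i < n ] (sum (term (S ∪ T) i) + sum (term (S ∩ T) i))
      ≡⟨ sum-cong-≗ (λ i → trans (sym (∑-distrib-+ (term (S ∪ T) i) _))
                                 (trans (sum-cong-≗ (split i)) (∑-distrib-+ (term S i) _))) ⟩
    ∑[ i < n ] (sum (term S i) + sum (term T i))
      ≡⟨ ∑-distrib-+ (λ i → sum (term S i)) _ ⟩
    arcs S + arcs T
      ∎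
    where
    open ≡-Reasoning
    term : VertexSet n → Fin n → Fin n → ℕ
    term U i j = ⟦ U i ∧ U j ∧ adj G i j ⟧
    pointwise : ∀ a b c d e →
      (a ≡ true → b ≡ false → d ≡ true → c ≡ false → e ≡ false) →
      (b ≡ true → a ≡ false → c ≡ true → d ≡ false → e ≡ false) →
      ⟦ (a ∨ b) ∧ (c ∨ d) ∧ e ⟧ + ⟦ (a ∧ b) ∧ (c ∧ d) ∧ e ⟧ ≡ ⟦ a ∧ c ∧ e ⟧ + ⟦ b ∧ d ∧ e ⟧
    pointwise true  b     true  d     e _ _ = refl
    pointwise false b     false d     e _ _ = +-identityʳ _
    pointwise true  true  false d     e _ _ = +-identityʳ _
    pointwise true  false false false e _ _ = refl
    pointwise true  false false true  e h _ rewrite h refl refl refl refl = refl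
    pointwise false b     true  true  e _ _ = +-identityʳ _
    pointwise false false true  false e _ _ = refl
    pointwise false true  true  false e _ h rewrite h refl refl refl refl = refl
    split : ∀ i j → term (S ∪ T) i j + term (S ∩ T) i j ≡ term S i j + term T i j
    split i j = pointwise (S i) (T i) (S j) (T j) (adj G i j) (no-cross i j)
      (λ i∈T i∉S j∈S j∉T → trans (Graph.sym G i j) (no-cross j i j∈S j∉T i∈T i∉S))

  arcs-full : arcs full ≡ edgeCount G + edgeCount G
  arcs-full = begin
    ∑[ i < n ] ∑[ j < n ] ⟦ adj G i j ⟧
      ≡⟨ sum-cong-≗ (λ i → sum-cong-≗ (orientations i)) ⟩
    ∑[ i < n ] ∑[ j < n ] (forward i j + forward j i)
      ≡⟨ sum-cong-≗ (λ i → ∑-distrib-+ (forward i) _) ⟩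
    ∑[ i < n ] (sum (forward i) + ∑[ j < n ] forward j i)
      ≡⟨ ∑-distrib-+ (λ i → sum (forward i)) _ ⟩
    ∑[ i < n ] sum (forward i) + ∑[ i < n ] ∑[ j < n ] forward j i
      ≡⟨ cong (∑[ i < n ] sum (forward i) +_) (∑-comm (λ i j → forward j i)) ⟩
    ∑[ i < n ] sum (forward i) + ∑[ j < n ] sum (forward j)
      ≡⟨ cong₂ _+_ edgeCount-∑ edgeCount-∑ ⟨
    edgeCount G + edgeCount G
      ∎
    where
    open ≡-Reasoning
    forward : Fin n → Fin n → ℕ
    forward i j = ⟦ ⌊ i <? j ⌋ ∧ adj G i j ⟧
    orientations : ∀ i j → ⟦ adj G i j ⟧ ≡ forward i j + forward j i
    orientations i j with Fin.<-cmp i j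
    ... | tri< i<j _ j≮i rewrite ⌊⌋-true (i <? j) i<j | ⌊⌋-false (j <? i) j≮i = sym (+-identityʳ _)
    ... | tri≈ _ refl _ rewrite ⌊⌋-false (i <? i) (Fin.<-irrefl refl) | irrefl G i = refl
    ... | tri> i≮j _ j<i rewrite ⌊⌋-false (i <? j) i≮j | ⌊⌋-true (j <? i) j<i =
      cong ⟦_⟧ (Graph.sym G i j)
    edgeCount-∑ : edgeCount G ≡ ∑[ i < n ] sum (forward i)
    edgeCount-∑ = trans (sum-map-tabulate (λ i → List.sum (map (forward i) (allFin n))) (λ i → i))
                         (sum-cong-≗ (λ i → sum-map-tabulate (forward i) (λ j → j)))

  size≡card : ∀ (H : Subgraph G) → size H ≡ card (V H)
  size≡card H = sum-map-tabulate (λ i → ⟦ V H i ⟧) (λ i → i)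

  -- arcs S counts ordered pairs, i.e. twice the edges of G[S], so Sparse (p + p) S says
  -- e(G[S]) ≤ p (|S| − 1), stated without subtraction.
  Sparse : ℕ → VertexSet n → Set
  Sparse k S = arcs S + k ≤ k * card S

  sparse-singleton : ∀ k {S} → card S ≡ 1 → Sparse k S
  sparse-singleton k {S} |S|≡1
    rewrite arcs-card≤1 {S} (≤-reflexive |S|≡1) | |S|≡1 = ≤-reflexive (sym (*-identityʳ k))

  sparse-∖ : ∀ {k S v} → S v ≡ true → degree S v + degree S v ≤ k → Sparse k (S ∖ v) → Sparse k S
  sparse-∖ {k} {S} {v} v∈S 2d≤k S∖v-sparse = begin
    arcs S + k                                   ≡⟨ cong (_+ k) (arcs-∖ v∈S) ⟩
    arcs (S ∖ v) + (degree S v + degree S v) + k ≤⟨ +-monoˡ-≤ k (+-monoʳ-≤ (arcs (S ∖ v)) 2d≤k) ⟩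
    arcs (S ∖ v) + k + k                         ≤⟨ +-monoˡ-≤ k S∖v-sparse ⟩
    k * card (S ∖ v) + k                         ≡⟨ +-comm _ k ⟩
    k + k * card (S ∖ v)                         ≡⟨ *-suc k _ ⟨
    k * suc (card (S ∖ v))                       ≡⟨ cong (k *_) (card-∖ {S = S} v∈S) ⟨
    k * card S                                   ∎
    where open ≤-Reasoning

  -- Separations and 2-connectivity

  record Separation (S X : VertexSet n) : Set where
    field
      left right : VertexSet n
      covers     : ∀ j → S j ≡ (left ∪ right) j
      overlap⊆   : (left ∩ right) ⊆ X
      no-cross   : ∀ i j → left i ≡ true → right i ≡ false → right j ≡ true → left j ≡ false →
                   adj G i j ≡ false
      left-only  : ∃ λ u → left u ≡ true × right u ≡ false
      right-only : ∃ λ v → right v ≡ true × left v ≡ false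

  module _ {S X : VertexSet n} (σ : Separation S X) where
    open Separation σ

    left⊆ : left ⊆ S
    left⊆ j j∈L = trans (covers j) (cong (_∨ right j) j∈L)

    right⊆ : right ⊆ S
    right⊆ j j∈R = trans (covers j) (trans (cong (left j ∨_) j∈R) (∨-zeroʳ (left j)))

    card-left< : card left < card S
    card-left< with right-only
    ... | v , v∈R , v∉L = card-⊂ left⊆ (right⊆ v v∈R) v∉L

    card-right< : card right < card S
    card-right< with left-only
    ... | u , u∈L , u∉R = card-⊂ right⊆ (left⊆ u u∈L) u∉R

    left-nonempty : 1 ≤ card left
    left-nonempty = member⇒card-positive {S = left} (proj₁ (proj₂ left-only))

    right-nonempty : 1 ≤ card right
    right-nonempty = member⇒card-positive {S = right} (proj₁ (proj₂ right-only))

    sparse-glue : ∀ {k} → card X ≤ 1 → Sparse k left → Sparse k right → Sparse k S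
    sparse-glue {k} |X|≤1 L-sparse R-sparse = +-cancelʳ-≤ k _ _ (begin
      arcs S + k + k                     ≡⟨ +-assoc (arcs S) k k ⟩
      arcs S + (k + k)                   ≡⟨ cong (_+ (k + k)) arcs-split ⟩
      arcs left + arcs right + (k + k)   ≡⟨ interchange (arcs left) (arcs right) k k ⟩
      (arcs left + k) + (arcs right + k) ≤⟨ +-mono-≤ L-sparse R-sparse ⟩
      k * card left + k * card right     ≡⟨ *-distribˡ-+ k (card left) (card right) ⟨
      k * (card left + card right)       ≡⟨ cong (k *_) card-split ⟨
      k * (card S + card (left ∩ right)) ≤⟨ *-monoʳ-≤ k (+-monoʳ-≤ (card S) |L∩R|≤1) ⟩
      k * (card S + 1)                   ≡⟨ *-distribˡ-+ k (card S) 1 ⟩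
      k * card S + k * 1                 ≡⟨ cong (k * card S +_) (*-identityʳ k) ⟩
      k * card S + k                     ∎)
      where
      open ≤-Reasoning
      |L∩R|≤1 : card (left ∩ right) ≤ 1
      |L∩R|≤1 = ≤-trans (card-mono overlap⊆) |X|≤1
      arcs-split : arcs S ≡ arcs left + arcs right
      arcs-split = begin-equality
        arcs S                                    ≡⟨ arcs-cong covers ⟩
        arcs (left ∪ right)                       ≡⟨ +-identityʳ _ ⟨
        arcs (left ∪ right) + 0                   ≡⟨ cong (arcs (left ∪ right) +_) (arcs-card≤1 |L∩R|≤1) ⟨
        arcs (left ∪ right) + arcs (left ∩ right) ≡⟨ arcs-∪-∩ left right no-cross ⟩
        arcs left + arcs right                    ∎
      card-split : card S + card (left ∩ right) ≡ card left + card right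
      card-split = trans (cong (_+ card (left ∩ right)) (card-cong covers)) (card-∪-∩ left right)

  IsInduced : Subgraph G → Set
  IsInduced H = ∀ i j → V H i ≡ true → V H j ≡ true → adj G i j ≡ true → E H i j ≡ true

  induced : VertexSet n → Subgraph G
  induced S = record
    { V     = S
    ; E     = λ i j → S i ∧ S j ∧ adj G i j
    ; E-sym = λ i j → trans (cong (λ a → S i ∧ S j ∧ a) (Graph.sym G i j)) (∧-left-swap (S i) (S j) _)
    ; E⊆adj = λ i j ij∈E → ∧-conicalʳ (S j) _ (∧-conicalʳ (S i) _ ij∈E)
    ; E⊆V   = λ i j ij∈E → ∧-conicalˡ (S i) _ ij∈E
    }

  induced-isInduced : ∀ S → IsInduced (induced S)
  induced-isInduced S i j i∈S j∈S i∼j = ∧-true i∈S (∧-true j∈S i∼j)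

  induced-─-isInduced : ∀ S x → IsInduced (induced S ─ x)
  induced-─-isInduced S x i j i∈S∖x j∈S∖x i∼j =
    ∧-true (∧-true (∧-conicalˡ (S i) _ i∈S∖x) (∧-true (∧-conicalˡ (S j) _ j∈S∖x) i∼j))
           (∧-true (∧-conicalʳ (S i) _ i∈S∖x) (∧-conicalʳ (S j) _ j∈S∖x))

  Reach-end : ∀ {H : Subgraph G} {u v} → Reach H u v → V H v ≡ true
  Reach-end (here v∈H)  = v∈H
  Reach-end (step _ r) = Reach-end r

  Reach-snoc : ∀ {H : Subgraph G} {u w v} → Reach H u w → E H w v ≡ true → Reach H u v
  Reach-snoc {H} {w = w} {v} (here _) wv∈E = step wv∈E (here (E⊆V H v w (trans (E-sym H v w) wv∈E)))
  Reach-snoc (step e r) wv∈E = step e (Reach-snoc r wv∈E)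

  module _ (H : Subgraph G) (H-induced : IsInduced H) {u} (reach? : ∀ j → Dec (Reach H u j)) where

    reachable : VertexSet n
    reachable j = ⌊ reach? j ⌋

    reachable⇒Reach : ∀ {j} → reachable j ≡ true → Reach H u j
    reachable⇒Reach {j} j∈R with reach? j
    ... | yes r = r

    reachable⊆V : reachable ⊆ V H
    reachable⊆V j j∈R = Reach-end (reachable⇒Reach j∈R)

    reachable-closed : ∀ {i j} → reachable i ≡ true → V H j ≡ true → adj G i j ≡ true → reachable j ≡ true
    reachable-closed {i} {j} i∈R j∈H i∼j =
      ⌊⌋-true (reach? j) (Reach-snoc (reachable⇒Reach i∈R) (H-induced i j (reachable⊆V i i∈R) j∈H i∼j))

    unreachable⇒separation : ∀ {S X} → (∀ j → S j ≡ (V H ∪ X) j) → (∀ j → V H j ≡ true → X j ≡ false) →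
      V H u ≡ true → ∀ {v} → V H v ≡ true → ¬ Reach H u v → Separation S X
    unreachable⇒separation {S} {X} S≗H∪X H∩X≡∅ u∈H {v} v∈H u↛v = record
      { left       = reachable ∪ X
      ; right      = unreached ∪ X
      ; covers     = λ j → trans (S≗H∪X j) (cover-split (reachable j) (V H j) (X j) (reachable⊆V j))
      ; overlap⊆   = λ j → overlap-split (reachable j) (V H j) (X j)
      ; no-cross   = no-cross
      ; left-only  = u , cong (_∨ X u) u∈R , u∉unreached∪X
      ; right-only = v , v∈unreached∪X , v∉R∪X
      }
      where
      unreached : VertexSet n
      unreached j = V H j ∧ not (reachable j)
      cover-split : ∀ r s x → (r ≡ true → s ≡ true) → s ∨ x ≡ (r ∨ x) ∨ ((s ∧ not r) ∨ x)
      cover-split true  s     x r⇒s rewrite r⇒s refl = refl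
      cover-split false true  x _   = sym (∨-zeroʳ x)
      cover-split false false x _   = sym (∨-idem x)
      overlap-split : ∀ r s x → (r ∨ x) ∧ ((s ∧ not r) ∨ x) ≡ true → x ≡ true
      overlap-split true  true  x both = both
      overlap-split true  false x both = both
      overlap-split false s     x both = ∧-conicalˡ x _ both
      u∈R : reachable u ≡ true
      u∈R = ⌊⌋-true (reach? u) (here u∈H)
      v∉R : reachable v ≡ false
      v∉R = ⌊⌋-false (reach? v) u↛v
      u∉unreached∪X : (unreached ∪ X) u ≡ false
      u∉unreached∪X rewrite u∈R | H∩X≡∅ u u∈H = trans (∨-identityʳ _) (∧-zeroʳ (V H u))
      v∈unreached∪X : (unreached ∪ X) v ≡ true
      v∈unreached∪X rewrite v∉R | v∈H = refl
      v∉R∪X : (reachable ∪ X) v ≡ false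
      v∉R∪X rewrite v∉R = H∩X≡∅ v v∈H
      no-cross : ∀ i j → (reachable ∪ X) i ≡ true → (unreached ∪ X) i ≡ false →
                 (unreached ∪ X) j ≡ true → (reachable ∪ X) j ≡ false → adj G i j ≡ false
      no-cross i j i∈R∪X i∉U∪X j∈U∪X j∉R∪X = ¬-not λ i∼j →
        case trans (sym j∉R) (reachable-closed i∈R j∈H i∼j) of λ ()
        where
        j∉R : reachable j ≡ false
        j∉R = ∨-conicalˡ _ _ j∉R∪X
        i∈R : reachable i ≡ true
        i∈R = ∨-resolveʳ i∈R∪X (∨-conicalʳ _ _ i∉U∪X)
        j∈H : V H j ≡ true
        j∈H = ∧-conicalˡ (V H j) _ (∨-resolveʳ j∈U∪X (∨-conicalʳ _ _ j∉R∪X))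

  no-separation⇒connected : ∀ {S X} (H : Subgraph G) → IsInduced H →
    (∀ j → S j ≡ (V H ∪ X) j) → (∀ j → V H j ≡ true → X j ≡ false) →
    ¬ Separation S X → (∃ λ u → V H u ≡ true) → ¬ ¬ Connected H
  no-separation⇒connected H H-induced S≗H∪X H∩X≡∅ ¬σ nonempty =
    ¬¬-map connected (¬¬-Π λ u → ¬¬-Π λ j → ¬¬-excluded-middle)
    where
    connected : (∀ u j → Dec (Reach H u j)) → Connected H
    connected reach? = nonempty , λ u v u∈H v∈H → decidable-stable (reach? u v) λ u↛v →
      ¬σ (unreachable⇒separation H H-induced (reach? u) S≗H∪X H∩X≡∅ u∈H v∈H u↛v)

  ¬¬-twoConnected : ∀ S → 3 ≤ card S → (∀ X → card X ≤ 1 → ¬ Separation S X) →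
                    ¬ ¬ TwoConnected (induced S)
  ¬¬-twoConnected S 3≤|S| no-sep ¬2conn =
    no-separation⇒connected (induced S) (induced-isInduced S) (λ j → sym (∨-identityʳ (S j)))
      (λ _ _ → refl) (no-sep ∅ (≤-trans (≤-reflexive (card-∅ {n})) z≤n))
      (card-positive⇒member S (≤-trans (s≤s z≤n) 3≤|S|)) λ S-conn →
    ¬¬-Π (λ x → ¬¬-→ (connected-─ x)) λ S─x-conn →
    ¬2conn (≤-trans 3≤|S| (≤-reflexive (sym (size≡card (induced S)))) , S-conn , S─x-conn)
    where
    connected-─ : ∀ x → S x ≡ true → ¬ ¬ Connected (induced S ─ x)
    connected-─ x x∈S =
      no-separation⇒connected (induced S ─ x) (induced-─-isInduced S x) (∖-∪-⁅⁆ x∈S)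
        (λ j j∈S∖x → ⌊⌋-false (j ≟ x) (∖-≢ S x j∈S∖x)) (no-sep ⁅ x ⁆ (≤-reflexive (card-⁅⁆ x)))
        (card-positive⇒member (S ∖ x)
          (≤-trans (s≤s z≤n) (≤-pred (≤-trans 3≤|S| (≤-reflexive (card-∖ {S = S} x∈S))))))

-- Maximal subgraphs

module _ {n : ℕ} (G : Graph n) where

  ⊑-refl : ∀ {H : Subgraph G} → H ⊑ H
  ⊑-refl = (λ _ i∈H → i∈H) , (λ _ _ ij∈H → ij∈H)

  ⊑-trans : ∀ {H H′ H″ : Subgraph G} → H ⊑ H′ → H′ ⊑ H″ → H ⊑ H″
  ⊑-trans (V⊆V′ , E⊆E′) (V′⊆V″ , E′⊆E″) =
    (λ i → V′⊆V″ i ∘ V⊆V′ i) , (λ i j → E′⊆E″ i j ∘ E⊆E′ i j)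

  ⊑-stable : ∀ {H H′ : Subgraph G} → ¬ ¬ (H ⊑ H′) → H ⊑ H′
  ⊑-stable {H} {H′} ¬¬H⊑H′ =
    (λ i i∈H → decidable-stable (V H′ i ≟ᵇ true)
                 (¬¬-map (λ H⊑H′ → proj₁ H⊑H′ i i∈H) ¬¬H⊑H′)) ,
    (λ i j ij∈H → decidable-stable (E H′ i j ≟ᵇ true)
                    (¬¬-map (λ H⊑H′ → proj₂ H⊑H′ i j ij∈H) ¬¬H⊑H′))

  weight : Subgraph G → ℕ
  weight H = card (V H) + ∑[ i < n ] card (E H i)

  weight-≤ : ∀ H → weight H ≤ n + n * n
  weight-≤ H = +-mono-≤ (card-≤ (V H))
                        (≤-trans (∑-mono-≤ (λ i → card-≤ (E H i))) (≤-reflexive (∑-const {n} n)))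

  weight-reflect : ∀ {H H′ : Subgraph G} → H ⊑ H′ → weight H′ ≤ weight H → H′ ⊑ H
  weight-reflect (V⊆V′ , E⊆E′) w′≤w
    with +-mono-≤-reflect (card-mono V⊆V′) (∑-mono-≤ (λ i → card-mono (E⊆E′ i))) w′≤w
  ... | |V′|≤|V| , ∑|E′|≤∑|E| =
    card-reflect V⊆V′ |V′|≤|V| ,
    λ i → card-reflect (E⊆E′ i) (∑-mono-≤-reflect (λ i → card-mono (E⊆E′ i)) ∑|E′|≤∑|E| i)

  module _ (P : Subgraph G → Set) where

    Maximal : Subgraph G → Set
    Maximal B = P B × (∀ H′ → P H′ → B ⊑ H′ → H′ ⊑ B)

    ¬¬-maximal-above : ∀ {H} → P H → ¬ ¬ (∃ λ B → Maximal B × H ⊑ B)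
    ¬¬-maximal-above {H} = go (<-wellFounded (n + n * n ∸ weight H))
      where
      go : ∀ {H} → Acc _<_ (n + n * n ∸ weight H) → P H → ¬ ¬ (∃ λ B → Maximal B × H ⊑ B)
      go {H} (acc smaller) PH ¬max = ¬max (H , (PH , maximal) , ⊑-refl {H})
        where
        maximal : ∀ H′ → P H′ → H ⊑ H′ → H′ ⊑ H
        maximal H′ PH′ H⊑H′ = ⊑-stable {H′} {H} λ H′⋢H →
          go (smaller (∸-monoʳ-< (≰⇒> (H′⋢H ∘ weight-reflect {H} {H′} H⊑H′)) (weight-≤ H′))) PH′
             λ (B , maxB , H′⊑B) → ¬max (B , maxB , ⊑-trans {H} {H′} {B} H⊑H′ H′⊑B)

-- Cycles

toℕ-next-< : ∀ {m} (j : Fin (suc m)) → toℕ j < m → toℕ (next j) ≡ suc (toℕ j)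
toℕ-next-< j j<m = trans (Fin.toℕ-fromℕ< _) (m<n⇒m%n≡m (s≤s j<m))

toℕ-next-last : ∀ {m} (j : Fin (suc m)) → toℕ j ≡ m → toℕ (next j) ≡ 0
toℕ-next-last {m} j j≡m =
  trans (Fin.toℕ-fromℕ< _) (trans (cong (λ a → suc a % suc m) j≡m) (n%n≡0 (suc m)))

next-injective : ∀ {m} {j j′ : Fin (suc m)} → next j ≡ next j′ → j ≡ j′
next-injective {m} {j} {j′} nj≡nj′
  with m≤n⇒m<n∨m≡n (Fin.toℕ≤pred[n] j) | m≤n⇒m<n∨m≡n (Fin.toℕ≤pred[n] j′)
... | inj₁ j<m | inj₁ j′<m = Fin.toℕ-injective (suc-injective
  (trans (sym (toℕ-next-< j j<m)) (trans (cong toℕ nj≡nj′) (toℕ-next-< j′ j′<m))))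
... | inj₂ j≡m | inj₂ j′≡m = Fin.toℕ-injective (trans j≡m (sym j′≡m))
... | inj₁ j<m | inj₂ j′≡m =
  case trans (sym (toℕ-next-< j j<m)) (trans (cong toℕ nj≡nj′) (toℕ-next-last j′ j′≡m)) of λ ()
... | inj₂ j≡m | inj₁ j′<m =
  case trans (sym (toℕ-next-< j′ j′<m)) (trans (cong toℕ (sym nj≡nj′)) (toℕ-next-last j j≡m)) of λ ()

module _ {n : ℕ} (G : Graph n) where

  cycle-degree≤2 : ∀ {B : Subgraph G} → IsCycle B → ∀ v → card (E B v) ≤ 2
  cycle-degree≤2 {B} (_ , _ , f , f-inj , V⊆f , _ , E⊆cycle , _) v =
    ≮⇒≥ λ 3≤deg → three-neighbours (three-members (E B v) 3≤deg)
    where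
    three-neighbours : ¬ ThreeDistinctMembers (E B v)
    three-neighbours (x , y , z , vx , vy , vz , x≢y , x≢z , y≢z) with V⊆f v (E⊆V B v x vx)
    ... | j₀ , fj₀≡v = pigeonhole (side vx) (side vy) (side vz)
      where
      Predecessor : Fin n → Set
      Predecessor w = ∃ λ j → next j ≡ j₀ × f j ≡ w
      side : ∀ {w} → E B v w ≡ true → f (next j₀) ≡ w ⊎ Predecessor w
      side {w} vw with E⊆cycle v w vw
      ... | j , inj₁ (fj≡v , fnj≡w) =
        inj₁ (trans (cong (f ∘ next) (f-inj (trans fj₀≡v (sym fj≡v)))) fnj≡w)
      ... | j , inj₂ (fj≡w , fnj≡v) = inj₂ (j , f-inj (trans fnj≡v (sym fj₀≡v)) , fj≡w)
      predecessor-unique : ∀ {w w′} → Predecessor w → Predecessor w′ → w ≡ w′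
      predecessor-unique (j , nj≡j₀ , fj≡w) (j′ , nj′≡j₀ , fj′≡w′) =
        trans (sym fj≡w) (trans (cong f (next-injective (trans nj≡j₀ (sym nj′≡j₀)))) fj′≡w′)
      pigeonhole : f (next j₀) ≡ x ⊎ Predecessor x → f (next j₀) ≡ y ⊎ Predecessor y →
                   f (next j₀) ≡ z ⊎ Predecessor z → ⊥
      pigeonhole (inj₁ p) (inj₁ q) _        = x≢y (trans (sym p) q)
      pigeonhole (inj₁ p) (inj₂ _) (inj₁ r) = x≢z (trans (sym p) r)
      pigeonhole (inj₁ _) (inj₂ q) (inj₂ r) = y≢z (predecessor-unique q r)
      pigeonhole (inj₂ _) (inj₁ q) (inj₁ r) = y≢z (trans (sym q) r)
      pigeonhole (inj₂ p) (inj₁ _) (inj₂ r) = x≢z (predecessor-unique p r)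
      pigeonhole (inj₂ p) (inj₂ q) _        = x≢y (predecessor-unique p q)

module _ (p : ℕ) (2≤p : 2 ≤ p) {n : ℕ} (G : Graph n)
  (no-big-block : ¬ (∃ λ (H : Subgraph G) → IsTwoConnectedComponent H × p ≤ size H × ¬ IsCycle H)) where

  module _ {S : VertexSet n}
           (smaller-sparse : ∀ T → card T < card S → 1 ≤ card T → Sparse G (p + p) T)
           (S-dense : ¬ Sparse G (p + p) S) where

    no-small-separation : ∀ X → card X ≤ 1 → ¬ Separation G S X
    no-small-separation X |X|≤1 σ = S-dense (sparse-glue G σ |X|≤1
      (smaller-sparse _ (card-left< G σ) (left-nonempty G σ))
      (smaller-sparse _ (card-right< G σ) (right-nonempty G σ)))

    high-degree⇒⊥ : ∀ {v₀} → S v₀ ≡ true → (∀ v → S v ≡ true → p < degree G S v) → ⊥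
    high-degree⇒⊥ {v₀} v₀∈S high =
      ¬¬-twoConnected G S 3≤|S| no-small-separation λ S-2conn →
      ¬¬-maximal-above G TwoConnected S-2conn λ (B , B-block , S⊑B) →
      no-big-block (B , B-block , p≤size B S⊑B , λ B-cycle →
        ≤⇒≯ (cycle-degree≤2 G {B} B-cycle v₀) (≤-trans 3≤deg (card-mono (neighbours⊆E B S⊑B))))
      where
      p<deg : p < degree G S v₀
      p<deg = high v₀ v₀∈S
      3≤deg : 3 ≤ degree G S v₀
      3≤deg = ≤-trans (s≤s 2≤p) p<deg
      2+p≤|S| : 2 + p ≤ card S
      2+p≤|S| = ≤-trans (s≤s (≤-trans p<deg (degree-≤ G S v₀)))
                        (≤-reflexive (sym (card-∖ {S = S} v₀∈S)))
      3≤|S| : 3 ≤ card S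
      3≤|S| = ≤-trans (+-monoʳ-≤ 2 (≤-trans (s≤s z≤n) 2≤p)) 2+p≤|S|
      p≤size : ∀ B → induced G S ⊑ B → p ≤ size B
      p≤size B (V⊆ , _) = ≤-trans (≤-trans (m≤n+m p 2) 2+p≤|S|)
                                  (≤-trans (card-mono V⊆) (≤-reflexive (sym (size≡card G B))))
      neighbours⊆E : ∀ B → induced G S ⊑ B → neighbours G S v₀ ⊆ E B v₀
      neighbours⊆E B (_ , E⊆) j j∼v₀ = E⊆ v₀ j (∧-true v₀∈S j∼v₀)

  sparse-acc : ∀ S → Acc _<_ (card S) → 1 ≤ card S → Sparse G (p + p) S
  sparse-acc S (acc smaller) 1≤|S| with Fin.any? (λ v → (S v ≟ᵇ true) ×-dec (degree G S v ≤? p))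
  ... | yes (v , v∈S , deg≤p) with 1 ≤? card (S ∖ v)
  ...   | yes 1≤|S∖v| =
    sparse-∖ G v∈S (+-mono-≤ deg≤p deg≤p)
      (sparse-acc (S ∖ v) (smaller (≤-reflexive (sym (card-∖ {S = S} v∈S)))) 1≤|S∖v|)
  ...   | no  1≰|S∖v| =
    sparse-singleton G (p + p) (trans (card-∖ {S = S} v∈S) (cong suc (n<1⇒n≡0 (≰⇒> 1≰|S∖v|))))
  sparse-acc S (acc smaller) 1≤|S| | no no-low-degree =
    decidable-stable (arcs G S + (p + p) ≤? (p + p) * card S) λ S-dense →
    high-degree⇒⊥ (λ T |T|<|S| → sparse-acc T (smaller |T|<|S|)) S-dense
      (proj₂ (card-positive⇒member S 1≤|S|))
      (λ v v∈S → ≰⇒> λ deg≤p → no-low-degree (v , v∈S , deg≤p))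

  sparse : ∀ S → 1 ≤ card S → Sparse G (p + p) S
  sparse S = sparse-acc S (<-wellFounded (card S))

lemma22 : (p : ℕ) → 2 ≤ p → (n : ℕ) → (G : Graph n) →
    Connected (whole G) →
    ¬ (∃ λ (H : Subgraph G) → IsTwoConnectedComponent H × p ≤ size H × ¬ IsCycle H) →
    edgeCount G < p * n
lemma22 p 2≤p n G ((u , _) , _) no-big-block = begin-strict
  edgeCount G      <⟨ m<m+n (edgeCount G) (≤-trans (s≤s z≤n) 2≤p) ⟩
  edgeCount G + p  ≤⟨ m+m≤n+n⇒m≤n double-bound ⟩
  p * n            ∎
  where
  open ≤-Reasoning
  e : ℕ
  e = edgeCount G
  double-bound : (e + p) + (e + p) ≤ p * n + p * n
  double-bound = begin
    (e + p) + (e + p)        ≡⟨ interchange e p e p ⟩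
    (e + e) + (p + p)        ≡⟨ cong (_+ (p + p)) (arcs-full G) ⟨
    arcs G full + (p + p)    ≤⟨ sparse p 2≤p G no-big-block full
                                  (member⇒card-positive {S = full {n}} {v = u} refl) ⟩
    (p + p) * card {n} full  ≡⟨ cong ((p + p) *_) (card-full {n}) ⟩
    (p + p) * n              ≡⟨ *-distribʳ-+ n p p ⟩
    p * n + p * n            ∎
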